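{- Let $G=(V,E)$ be an undirected connected multi-graph with Steiner set $S\subseteq V$ and $S$-mincut capacity $\lambda_S$. Let $C_1,C_2,C_3$ be three Steiner cuts of capacity $\lambda_S+1$ and let $V_a=C_1\cap\overline{C_2}\cap\overline{C_3}$, $V_b=\overline{C_1}\cap C_2\cap\overline{C_3}$, $V_c=\overline{C_1}\cap\overline{C_2}\cap C_3$. If each of the three sets $V_a,V_b,V_c$ contains a Steiner vertex and a vertex from the same $(\lambda_S+1)$-connectivity class $\mathcal{W}$ of $G$, then $C_1\cap C_2\cap C_3=\emptyset$.
   Context: $\overline{X}=V\setminus X$; the capacity of a cut is the number of edges with exactly one endpoint in it. A Steiner cut is a set $C\subset V$ containing some but not all vertices of $S$; an $S$-mincut is a Steiner cut of minimum capacity $\lambda_S$. The $(\lambda_S+1)$-connectivity classes are the equivalence classes of the relation "$u$ and $v$ are not separated by any $S$-mincut" (a cut separates $u,v$ if it contains exactly one of them). -}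

module Defs where

open import Data.Nat using (ℕ; _≤_; _+_; suc)
open import Data.Fin using (Fin)
open import Data.Bool using (Bool; true; false; not; _∧_; _xor_)
open import Data.List using (List; map)
open import Data.Nat.ListAction using (sum)
open import Data.List.Membership.Propositional using (_∈_)
open import Data.Product using (_×_; _,_; Σ; ∃; ∃-syntax)
open import Data.Sum using (_⊎_)
open import Relation.Binary.PropositionalEquality using (_≡_)
open import Relation.Binary.Construct.Closure.ReflexiveTransitive using (Star)
open import Relation.Nullary using (¬_)

-- An undirected multigraph on vertex set V = Fin n, given by a list of
-- edges (repetitions = parallel edges; each pair (u , v) is an undirected edge).
record Graph : Set where
  field
    n     : ℕ
    edges : List (Fin n × Fin n)
open Graph public

VSet : Graph → Set
VSet G = Fin (n G) → Bool

_∈ᵥ_ : {k : ℕ} → Fin k → (Fin k → Bool) → Set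
v ∈ᵥ X = X v ≡ true

co : {k : ℕ} → (Fin k → Bool) → (Fin k → Bool)
co X v = not (X v)

_∩_ : {k : ℕ} → (Fin k → Bool) → (Fin k → Bool) → (Fin k → Bool)
(X ∩ Y) v = X v ∧ Y v

Adjacent : (G : Graph) → Fin (n G) → Fin (n G) → Set
Adjacent G u v = ((u , v) ∈ edges G) ⊎ ((v , u) ∈ edges G)

Connected : Graph → Set
Connected G = ∀ u v → Star (Adjacent G) u v

crosses : {G : Graph} → VSet G → Fin (n G) × Fin (n G) → ℕ
crosses X (u , v) with X u xor X v
... | true  = 1
... | false = 0

cap : (G : Graph) → VSet G → ℕ
cap G X = sum (map (crosses {G} X) (edges G))

SteinerCut : (G : Graph) → VSet G → VSet G → Set
SteinerCut G S C = (∃[ s ] (s ∈ᵥ S × s ∈ᵥ C)) × (∃[ s ] (s ∈ᵥ S × ¬ (s ∈ᵥ C)))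

IsSMincutCap : (G : Graph) → VSet G → ℕ → Set
IsSMincutCap G S λS =
  (∃[ C ] (SteinerCut G S C × cap G C ≡ λS)) ×
  (∀ C → SteinerCut G S C → λS ≤ cap G C)

SMincut : (G : Graph) → VSet G → ℕ → VSet G → Set
SMincut G S λS C = SteinerCut G S C × cap G C ≡ λS

Separates : {G : Graph} → VSet G → Fin (n G) → Fin (n G) → Set
Separates X u v = (X u xor X v) ≡ true

-- u, v lie in the same (λ_S+1)-connectivity class: no S-mincut separates them
SameClass : (G : Graph) → VSet G → ℕ → Fin (n G) → Fin (n G) → Set
SameClass G S λS u v = ∀ C → SMincut G S λS C → ¬ Separates {G} C u v

InClassOf : (G : Graph) → VSet G → ℕ → Fin (n G) → Fin (n G) → Set
InClassOf G S λS w v = SameClass G S λS w v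

{-# OPTIONS --safe #-}

-- Each of V_a, V_b, V_c contains a Steiner vertex and a vertex of 𝒲 and misses the ones of the
-- next set in the cycle V_a → V_b → V_c → V_a, so it is a Steiner cut separating two vertices of
-- one (λ_S+1)-class; hence it is no S-mincut and has capacity at least λ_S + 1.  The four sets
-- V_a, V_b, V_c, C₁ ∩ C₂ ∩ C₃ are the atoms of the Venn diagram of C₁, C₂, C₃ lying in an odd
-- number of the Cᵢ, and every edge crosses at most as many of them as of C₁, C₂, C₃.  Summing
-- over the edges, the four capacities add up to at most 3(λ_S + 1), so C₁ ∩ C₂ ∩ C₃ is crossed by
-- no edge.  In a connected graph such a set is ∅ or V, and it misses the Steiner vertex of V_a.

module Submission where

open import Defs
open import Data.Nat using (ℕ; suc)
open import Data.Bool using (false)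
open import Data.Product using (_×_; ∃-syntax)
open import Relation.Binary.PropositionalEquality using (_≡_)

open import Algebra.Properties.CommutativeSemigroup using (interchange)
open import Data.Bool using (Bool; true; not; _∧_; _xor_; if_then_else_; _≟_)
open import Data.Bool.Properties using (∧-identityʳ; not-¬)
open import Data.Fin using (Fin)
open import Data.List using (List; []; _∷_; map)
open import Data.List.Membership.Propositional using (_∈_)
open import Data.List.Properties using (map-cong)
open import Data.List.Relation.Unary.Any using (here; there)
open import Data.Nat using (_≤_; _<_; _+_; z≤n; _≤?_)
open import Data.Nat.ListAction using (sum)
open import Data.Nat.Properties
  using (+-mono-≤; ≤∧≢⇒<; n≤0⇒n≡0; m+n≡0⇒m≡0; m+n≡0⇒n≡0; +-cancelʳ-≤; +-commutativeSemigroup;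
         module ≤-Reasoning)
open import Data.Product using (_,_; proj₁; proj₂)
open import Data.Sum using (_⊎_; inj₁; inj₂; [_,_]′)
open import Function using (_on_)
open import Relation.Binary.Construct.Closure.ReflexiveTransitive using (fold)
open import Relation.Binary.PropositionalEquality
  using (refl; sym; trans; cong; cong₂; module ≡-Reasoning)
open import Relation.Nullary using (Dec; ¬_)
open import Relation.Nullary.Decidable using (map′; _×-dec_; toWitness)
open import Relation.Unary using (Decidable)

∀-Bool? : {P : Bool → Set} → Decidable P → Dec (∀ b → P b)
∀-Bool? P? = map′ (λ (t , f) → λ { true → t ; false → f }) (λ h → h true , h false) (P? true ×-dec P? false)

mismatch : Bool → Bool → ℕ
mismatch p q = if p xor q then 1 else 0

mismatch≡0⇒≡ : ∀ p q → mismatch p q ≡ 0 → p ≡ q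
mismatch≡0⇒≡ true  true  _ = refl
mismatch≡0⇒≡ false false _ = refl

xor-split : ∀ r p q → p xor q ≡ true → r xor p ≡ true ⊎ r xor q ≡ true
xor-split true  true  q h = inj₂ h
xor-split true  false q h = inj₁ refl
xor-split false true  q h = inj₁ refl
xor-split false false q h = inj₂ h

odd-atoms-disjoint : ∀ a b c →
  ((a ∧ not b) ∧ not c) ∧ ((not a ∧ b) ∧ not c) ≡ false ×
  ((not a ∧ b) ∧ not c) ∧ ((not a ∧ not b) ∧ c) ≡ false ×
  ((not a ∧ not b) ∧ c) ∧ ((a ∧ not b) ∧ not c) ≡ false ×
  ((a ∧ b) ∧ c) ∧ ((a ∧ not b) ∧ not c) ≡ false
odd-atoms-disjoint = toWitness {a? = ∀-Bool? λ a → ∀-Bool? λ b → ∀-Bool? λ c →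
  (_ ≟ false) ×-dec (_ ≟ false) ×-dec (_ ≟ false) ×-dec (_ ≟ false)} _

-- Distinct odd atoms differ in at least two of the three coordinates.
odd-atoms-mismatch-≤ : ∀ a b c d e f →
  mismatch ((a ∧ b) ∧ c) ((d ∧ e) ∧ f)
    + (mismatch ((a ∧ not b) ∧ not c) ((d ∧ not e) ∧ not f)
    + (mismatch ((not a ∧ b) ∧ not c) ((not d ∧ e) ∧ not f)
    + (mismatch ((not a ∧ not b) ∧ c) ((not d ∧ not e) ∧ f) + 0)))
  ≤ mismatch a d + (mismatch b e + (mismatch c f + 0))
odd-atoms-mismatch-≤ = toWitness {a? = ∀-Bool? λ a → ∀-Bool? λ b → ∀-Bool? λ c →
  ∀-Bool? λ d → ∀-Bool? λ e → ∀-Bool? λ f → _ ≤? _} _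

m+n≤n⇒m≡0 : ∀ {m n} → m + n ≤ n → m ≡ 0
m+n≤n⇒m≡0 {m} {n} m+n≤n = n≤0⇒n≡0 (+-cancelʳ-≤ n m 0 m+n≤n)

module _ {A : Set} where

  sum-map-+ : (f g : A → ℕ) (xs : List A) →
              sum (map (λ x → f x + g x) xs) ≡ sum (map f xs) + sum (map g xs)
  sum-map-+ f g []       = refl
  sum-map-+ f g (x ∷ xs) = begin
    (f x + g x) + sum (map (λ x → f x + g x) xs)   ≡⟨ cong (f x + g x +_) (sum-map-+ f g xs) ⟩
    (f x + g x) + (sum (map f xs) + sum (map g xs)) ≡⟨ interchange +-commutativeSemigroup (f x) (g x) _ _ ⟩
    (f x + sum (map f xs)) + (g x + sum (map g xs)) ∎
    where open ≡-Reasoning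

  sum-map-mono-≤ : {f g : A → ℕ} → (∀ x → f x ≤ g x) → (xs : List A) → sum (map f xs) ≤ sum (map g xs)
  sum-map-mono-≤ f≤g []       = z≤n
  sum-map-mono-≤ f≤g (x ∷ xs) = +-mono-≤ (f≤g x) (sum-map-mono-≤ f≤g xs)

  sum-map≡0⇒≡0 : (f : A → ℕ) {xs : List A} → sum (map f xs) ≡ 0 → ∀ {x} → x ∈ xs → f x ≡ 0
  sum-map≡0⇒≡0 f {y ∷ _} Σ≡0 (here refl) = m+n≡0⇒m≡0 (f y) Σ≡0
  sum-map≡0⇒≡0 f {y ∷ _} Σ≡0 (there x∈xs) = sum-map≡0⇒≡0 f (m+n≡0⇒n≡0 (f y) Σ≡0) x∈xs

module _ {k : ℕ} where

  Disjoint : (A B : Fin k → Bool) → Set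
  Disjoint A B = ∀ v → (A ∩ B) v ≡ false

  disjoint⇒∉ : {A B : Fin k → Bool} → Disjoint A B → ∀ {v} → v ∈ᵥ B → A v ≡ false
  disjoint⇒∉ {A} {B} A#B {v} v∈B = begin
    A v         ≡⟨ ∧-identityʳ (A v) ⟨
    A v ∧ true  ≡⟨ cong (A v ∧_) v∈B ⟨
    A v ∧ B v   ≡⟨ A#B v ⟩
    false       ∎
    where open ≡-Reasoning

  crossCount : List (Fin k → Bool) → Fin k × Fin k → ℕ
  crossCount Xs (u , v) = sum (map (λ X → mismatch (X u) (X v)) Xs)

module OddAtoms {k : ℕ} (C₁ C₂ C₃ : Fin k → Bool) where

  Va Vb Vc R : Fin k → Bool
  Va = (C₁ ∩ co C₂) ∩ co C₃
  Vb = (co C₁ ∩ C₂) ∩ co C₃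
  Vc = (co C₁ ∩ co C₂) ∩ C₃
  R  = (C₁ ∩ C₂) ∩ C₃

  Va#Vb : Disjoint Va Vb
  Va#Vb v = proj₁ (odd-atoms-disjoint (C₁ v) (C₂ v) (C₃ v))

  Vb#Vc : Disjoint Vb Vc
  Vb#Vc v = proj₁ (proj₂ (odd-atoms-disjoint (C₁ v) (C₂ v) (C₃ v)))

  Vc#Va : Disjoint Vc Va
  Vc#Va v = proj₁ (proj₂ (proj₂ (odd-atoms-disjoint (C₁ v) (C₂ v) (C₃ v))))

  R#Va : Disjoint R Va
  R#Va v = proj₂ (proj₂ (proj₂ (odd-atoms-disjoint (C₁ v) (C₂ v) (C₃ v))))

  crossCount-odd-atoms-≤ : ∀ e → crossCount (R ∷ Va ∷ Vb ∷ Vc ∷ []) e ≤ crossCount (C₁ ∷ C₂ ∷ C₃ ∷ []) e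
  crossCount-odd-atoms-≤ (u , v) = odd-atoms-mismatch-≤ (C₁ u) (C₂ u) (C₃ u) (C₁ v) (C₂ v) (C₃ v)

module _ (G : Graph) where

  crosses≡mismatch : (X : VSet G) (u v : Fin (n G)) → crosses {G} X (u , v) ≡ mismatch (X u) (X v)
  crosses≡mismatch X u v with X u xor X v
  ... | true  = refl
  ... | false = refl

  capSum : List (VSet G) → ℕ
  capSum Xs = sum (map (cap G) Xs)

  capSum≡sum-crossCount : (Xs : List (VSet G)) → capSum Xs ≡ sum (map (crossCount Xs) (edges G))
  capSum≡sum-crossCount []       = sym (sum-zeros (edges G))
    where
    sum-zeros : ∀ es → sum (map (λ _ → 0) es) ≡ 0
    sum-zeros []       = refl
    sum-zeros (_ ∷ es) = sum-zeros es
  capSum≡sum-crossCount (X ∷ Xs) = begin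
    cap G X + capSum Xs
      ≡⟨ cong₂ _+_ (cong sum (map-cong (λ (u , v) → crosses≡mismatch X u v) (edges G)))
                   (capSum≡sum-crossCount Xs) ⟩
    sum (map (λ (u , v) → mismatch (X u) (X v)) (edges G)) + sum (map (crossCount Xs) (edges G))
      ≡⟨ sum-map-+ _ _ (edges G) ⟨
    sum (map (crossCount (X ∷ Xs)) (edges G)) ∎
    where open ≡-Reasoning

  capSum-mono-≤ : (Xs Ys : List (VSet G)) → (∀ e → crossCount Xs e ≤ crossCount Ys e) → capSum Xs ≤ capSum Ys
  capSum-mono-≤ Xs Ys fewer-crossings = begin
    capSum Xs                                ≡⟨ capSum≡sum-crossCount Xs ⟩
    sum (map (crossCount Xs) (edges G))      ≤⟨ sum-map-mono-≤ fewer-crossings (edges G) ⟩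
    sum (map (crossCount Ys) (edges G))      ≡⟨ capSum≡sum-crossCount Ys ⟨
    capSum Ys                                ∎
    where open ≤-Reasoning

  capSum-odd-atoms-≤ : (C₁ C₂ C₃ : VSet G) → let open OddAtoms C₁ C₂ C₃ in
                       capSum (R ∷ Va ∷ Vb ∷ Vc ∷ []) ≤ capSum (C₁ ∷ C₂ ∷ C₃ ∷ [])
  capSum-odd-atoms-≤ C₁ C₂ C₃ = capSum-mono-≤ (R ∷ Va ∷ Vb ∷ Vc ∷ []) (C₁ ∷ C₂ ∷ C₃ ∷ []) crossCount-odd-atoms-≤
    where open OddAtoms C₁ C₂ C₃

  cap≡0⇒constant : Connected G → (X : VSet G) → cap G X ≡ 0 → ∀ u v → X u ≡ X v
  cap≡0⇒constant connected X cap≡0 u v = fold (_≡_ on X) (λ u~v → trans (adjacent⇒≡ u~v)) refl (connected u v)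
    where
    uncrossed : ∀ {u v} → (u , v) ∈ edges G → X u ≡ X v
    uncrossed {u} {v} uv∈E = mismatch≡0⇒≡ (X u) (X v)
      (trans (sym (crosses≡mismatch X u v)) (sum-map≡0⇒≡0 (crosses {G} X) cap≡0 uv∈E))
    adjacent⇒≡ : ∀ {u v} → Adjacent G u v → X u ≡ X v
    adjacent⇒≡ (inj₁ uv∈E) = uncrossed uv∈E
    adjacent⇒≡ (inj₂ vu∈E) = sym (uncrossed vu∈E)

  module _ {S : VSet G} {λS : ℕ} where

    sameClass-euclidean : ∀ {w x y} → SameClass G S λS w x → SameClass G S λS w y → SameClass G S λS x y
    sameClass-euclidean {w} {x} {y} w~x w~y C C-min C-sep =
      [ w~x C C-min , w~y C C-min ]′ (xor-split (C w) (C x) (C y) C-sep)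

    separating⇒λ<cap : IsSMincutCap G S λS → ∀ {X x y} → SteinerCut G S X → SameClass G S λS x y →
                       Separates {G} X x y → λS < cap G X
    separating⇒λ<cap (_ , minimal) {X} X-cut x~y X-sep =
      ≤∧≢⇒< (minimal X X-cut) (λ λ≡cap → x~y X (X-cut , sym λ≡cap) X-sep)

    HasSteinerAndClassVertex : Fin (n G) → VSet G → Set
    HasSteinerAndClassVertex w X = (∃[ s ] (s ∈ᵥ S × s ∈ᵥ X)) × (∃[ x ] (InClassOf G S λS w x × x ∈ᵥ X))

    disjoint⇒λ<cap : IsSMincutCap G S λS → ∀ {w} {A B : VSet G} → Disjoint A B →
                     HasSteinerAndClassVertex w A → HasSteinerAndClassVertex w B → λS < cap G A
    disjoint⇒λ<cap mincut {A = A} {B} A#B ((s , s∈S , s∈A) , (x , w~x , x∈A)) ((t , t∈S , t∈B) , (y , w~y , y∈B)) =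
      separating⇒λ<cap mincut ((s , s∈S , s∈A) , (t , t∈S , t∉A)) (sameClass-euclidean w~x w~y) A-sep
      where
      t∉A : ¬ t ∈ᵥ A
      t∉A t∈A = not-¬ t∈A (disjoint⇒∉ {A = A} {B} A#B t∈B)
      A-sep : Separates {G} A x y
      A-sep = cong₂ _xor_ x∈A (disjoint⇒∉ {A = A} {B} A#B y∈B)

lemma37 : (G : Graph) → Connected G → (S : VSet G) → (λS : ℕ) →
    IsSMincutCap G S λS →
    (C₁ C₂ C₃ : VSet G) →
    SteinerCut G S C₁ → cap G C₁ ≡ suc λS →
    SteinerCut G S C₂ → cap G C₂ ≡ suc λS →
    SteinerCut G S C₃ → cap G C₃ ≡ suc λS →
    (∃[ w ]
      ((∃[ s ] (s ∈ᵥ S × s ∈ᵥ ((C₁ ∩ co C₂) ∩ co C₃))) ×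
       (∃[ x ] (InClassOf G S λS w x × x ∈ᵥ ((C₁ ∩ co C₂) ∩ co C₃))) ×
       (∃[ s ] (s ∈ᵥ S × s ∈ᵥ ((co C₁ ∩ C₂) ∩ co C₃))) ×
       (∃[ x ] (InClassOf G S λS w x × x ∈ᵥ ((co C₁ ∩ C₂) ∩ co C₃))) ×
       (∃[ s ] (s ∈ᵥ S × s ∈ᵥ ((co C₁ ∩ co C₂) ∩ C₃))) ×
       (∃[ x ] (InClassOf G S λS w x × x ∈ᵥ ((co C₁ ∩ co C₂) ∩ C₃))))) →
    ∀ v → ((C₁ ∩ C₂) ∩ C₃) v ≡ false
lemma37 G connected S λS mincut C₁ C₂ C₃ _ cap₁ _ cap₂ _ cap₃
  (_ , sa@(s , _ , s∈Va) , xa , sb , xb , sc , xc) v =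
  trans (cap≡0⇒constant G connected R cap-R≡0 v s) (disjoint⇒∉ {A = R} {Va} R#Va s∈Va)
  where
  open OddAtoms C₁ C₂ C₃
  open ≤-Reasoning
  Va-Vb-Vc-exceed-λ : suc λS + (suc λS + (suc λS + 0)) ≤ capSum G (Va ∷ Vb ∷ Vc ∷ [])
  Va-Vb-Vc-exceed-λ = +-mono-≤ (disjoint⇒λ<cap G mincut Va#Vb (sa , xa) (sb , xb))
             (+-mono-≤ (disjoint⇒λ<cap G mincut Vb#Vc (sb , xb) (sc , xc))
             (+-mono-≤ (disjoint⇒λ<cap G mincut Vc#Va (sc , xc) (sa , xa)) z≤n))
  cap-R≡0 : cap G R ≡ 0
  cap-R≡0 = m+n≤n⇒m≡0 (begin
    capSum G (R ∷ Va ∷ Vb ∷ Vc ∷ [])  ≤⟨ capSum-odd-atoms-≤ G C₁ C₂ C₃ ⟩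
    capSum G (C₁ ∷ C₂ ∷ C₃ ∷ [])      ≡⟨ cong₂ _+_ cap₁ (cong₂ _+_ cap₂ (cong (_+ 0) cap₃)) ⟩
    suc λS + (suc λS + (suc λS + 0))  ≤⟨ Va-Vb-Vc-exceed-λ ⟩
    capSum G (Va ∷ Vb ∷ Vc ∷ [])      ∎)
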